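{- Let $t_1,\dots,t_n\in\mathbb{R}$, and for each $i=1,\dots,n$ let $F^i=(f^i_1,\dots,f^i_d)$ be a basis of $\mathbb{R}[t]_{<d}$. Then the linear matroid of the rows of the matrix $P_{F^1,\dots,F^n}(t_1,\dots,t_n)$ does not depend on the choice of the bases $F^1,\dots,F^n$.
   Context: $\mathbb{R}[t]_{<d}$ is the $d$-dimensional space of real univariate polynomials of degree less than $d$. The matrix $P_{F^1,\dots,F^n}(t_1,\dots,t_n)$ has rows indexed by pairs $\{i,j\}\in\binom{[n]}{2}$ ($i<j$) and $nd$ columns grouped into $n$ blocks of size $d$; row $\{i,j\}$ has $F^i(t_j)=(f^i_1(t_j),\dots,f^i_d(t_j))$ in block $i$, $-F^j(t_i)$ in block $j$, and zeros elsewhere. The row matroid has ground set $\binom{[n]}{2}$. -}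

module Defs where

open import Level using (Level; _⊔_) renaming (suc to lsuc)
open import Data.Nat using (ℕ; zero; suc)
open import Data.Fin using (Fin; zero; suc; _<_; _<?_; _≟_; toℕ)
open import Data.Bool using (Bool; false)
open import Data.Product using (Σ; ∃; _×_; _,_)
open import Relation.Nullary using (¬_; yes; no)
open import Relation.Binary.PropositionalEquality using (_≡_)
open import Algebra.Bundles using (CommutativeRing)

record Field (c ℓ : Level) : Set (lsuc (c ⊔ ℓ)) where
  field
    commutativeRing : CommutativeRing c ℓ
  open CommutativeRing commutativeRing public
  field
    0≉1     : ¬ (0# ≈ 1#)
    inverse : ∀ x → ¬ (x ≈ 0#) → ∃ λ y → x * y ≈ 1#

module _ {c ℓ : Level} (K : Field c ℓ) where
  open Field K using (Carrier; _≈_; _+_; _*_; -_; 0#; 1#)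

  sumF : (m : ℕ) → (Fin m → Carrier) → Carrier
  sumF zero    g = 0#
  sumF (suc m) g = g zero + sumF m (λ i → g (suc i))

  pow : Carrier → ℕ → Carrier
  pow x zero    = 1#
  pow x (suc k) = x * pow x k

  -- K[t]_{<d}: polynomials of degree < d, given by their d coefficients
  Poly : ℕ → Set c
  Poly d = Fin d → Carrier

  eval : {d : ℕ} → Poly d → Carrier → Carrier
  eval {d} p x = sumF d (λ k → p k * pow x (toℕ k))

  LinIndep : {m d : ℕ} → (Fin m → Poly d) → Set (c ⊔ ℓ)
  LinIndep {m} {d} v =
    (a : Fin m → Carrier) →
    (∀ k → sumF m (λ j → a j * v j k) ≈ 0#) → ∀ j → a j ≈ 0#

  Spans : {m d : ℕ} → (Fin m → Poly d) → Set (c ⊔ ℓ)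
  Spans {m} {d} v =
    (p : Poly d) → ∃ λ (a : Fin m → Carrier) →
      ∀ k → p k ≈ sumF m (λ j → a j * v j k)

  IsBasis : {d : ℕ} → (Fin d → Poly d) → Set (c ⊔ ℓ)
  IsBasis F = LinIndep F × Spans F

-- the ground set binom([n],2): pairs {i,j} written with i < j
Pair : ℕ → Set
Pair n = Σ (Fin n) λ i → Σ (Fin n) λ j → i < j

module _ {c ℓ : Level} (K : Field c ℓ) where
  open Field K using (Carrier; _≈_; _+_; _*_; -_; 0#; 1#)

  sumPairs : (n : ℕ) → (Pair n → Carrier) → Carrier
  sumPairs n g = sumF K n (λ i → sumF K n (λ j → h i j))
    where
    h : Fin n → Fin n → Carrier
    h i j with i <? j
    ... | yes p = g (i , j , p)
    ... | no _  = 0#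

  -- entry of P_{F^1,…,F^n}(t_1,…,t_n) in row {i,j} and column (block b, index k):
  -- F^i_k(t_j) if b = i, -F^j_k(t_i) if b = j, 0 otherwise.
  Pmat : {n d : ℕ} → (Fin n → Carrier) → (Fin n → Fin d → Poly K d) →
         Pair n → Fin n → Fin d → Carrier
  Pmat t F (i , j , _) b k with b ≟ i | b ≟ j
  ... | yes _ | _     = eval K (F i k) (t j)
  ... | no _  | yes _ = - eval K (F j k) (t i)
  ... | no _  | no _  = 0#

  -- S ⊆ binom([n],2) is independent in the row matroid of P_F(t):
  -- the rows indexed by S are linearly independent over K.
  RowIndep : {n d : ℕ} → (Fin n → Carrier) → (Fin n → Fin d → Poly K d) →
             (Pair n → Bool) → Set (c ⊔ ℓ)
  RowIndep {n} {d} t F S =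
    (a : Pair n → Carrier) →
    (∀ e → S e ≡ false → a e ≈ 0#) →
    (∀ b k → sumPairs n (λ e → a e * Pmat t F e b k) ≈ 0#) →
    ∀ e → a e ≈ 0#

-- Changing the basis of block b is a column operation on P(t): writing f^b_k = Σ_l A^b_{kl} g^b_l,
-- every column (b,k) of P_F is the combination Σ_l A^b_{kl} · (column (b,l) of P_G), both in the
-- entries F^b_k(t_j) and in the negated entries -F^b_k(t_i).  So every linear relation among rows
-- of P_G also holds among the same rows of P_F, and rows independent in P_F are independent in
-- P_G.
{-# OPTIONS --safe #-}
module Submission where

open import Defs
open import Level using (Level)
open import Data.Nat using (ℕ; zero; suc)
open import Data.Fin using (Fin; zero; suc; _<_; _<?_; _≟_; toℕ)
open import Data.Bool using (Bool)
open import Data.Product using (Σ; _,_; proj₁; proj₂)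
open import Function.Base using (_∘_)
open import Function.Bundles using (_⇔_; mk⇔)
open import Relation.Nullary using (Dec; yes; no)
open import Relation.Binary.PropositionalEquality as ≡ using (_≡_)
import Algebra.Properties.Semiring.Sum as SemiringSum
import Algebra.Properties.Ring as RingProperties
import Algebra.Properties.CommutativeSemigroup as CommutativeSemigroupProperties
import Relation.Binary.Reasoning.Setoid as SetoidReasoning

module _ {c ℓ : Level} (K : Field c ℓ) where
  open Field K hiding (zero)
  open SemiringSum semiring using (sum; sum-cong-≋; sum-cong-≗; sum-replicate-zero; ∑-comm; *-distribˡ-sum; *-distribʳ-sum)
  open RingProperties ring using (-0#≈0#; -‿+-comm; -‿distribʳ-*)
  open CommutativeSemigroupProperties *-commutativeSemigroup using (x∙yz≈y∙xz)
  open SetoidReasoning setoid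

  sumF≡sum : ∀ m (f : Fin m → Carrier) → sumF K m f ≡ sum f
  sumF≡sum zero    f = ≡.refl
  sumF≡sum (suc m) f = ≡.cong (f zero +_) (sumF≡sum m (f ∘ suc))

  sumF-cong : ∀ m {f g : Fin m → Carrier} → (∀ i → f i ≈ g i) → sumF K m f ≈ sumF K m g
  sumF-cong m {f} {g} f≈g = begin
    sumF K m f  ≡⟨ sumF≡sum m f ⟩
    sum f       ≈⟨ sum-cong-≋ f≈g ⟩
    sum g       ≡⟨ sumF≡sum m g ⟨
    sumF K m g  ∎

  sumF-zero : ∀ m → sumF K m (λ _ → 0#) ≈ 0#
  sumF-zero m = trans (reflexive (sumF≡sum m _)) (sum-replicate-zero m)

  *-distribˡ-sumF : ∀ m x (f : Fin m → Carrier) → x * sumF K m f ≈ sumF K m (λ i → x * f i)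
  *-distribˡ-sumF m x f = begin
    x * sumF K m f              ≡⟨ ≡.cong (x *_) (sumF≡sum m f) ⟩
    x * sum f                   ≈⟨ *-distribˡ-sum x f ⟩
    sum (λ i → x * f i)         ≡⟨ sumF≡sum m _ ⟨
    sumF K m (λ i → x * f i)    ∎

  *-distribʳ-sumF : ∀ m x (f : Fin m → Carrier) → sumF K m f * x ≈ sumF K m (λ i → f i * x)
  *-distribʳ-sumF m x f = begin
    sumF K m f * x              ≡⟨ ≡.cong (_* x) (sumF≡sum m f) ⟩
    sum f * x                   ≈⟨ *-distribʳ-sum x f ⟩
    sum (λ i → f i * x)         ≡⟨ sumF≡sum m _ ⟨
    sumF K m (λ i → f i * x)    ∎

  sumF-comm : ∀ m n (f : Fin m → Fin n → Carrier) →
              sumF K m (λ i → sumF K n (f i)) ≈ sumF K n (λ j → sumF K m (λ i → f i j))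
  sumF-comm m n f = begin
    sumF K m (λ i → sumF K n (f i))              ≡⟨ double-sumF≡sum m n f ⟩
    sum (λ i → sum (f i))                        ≈⟨ ∑-comm f ⟩
    sum (λ j → sum (λ i → f i j))                ≡⟨ double-sumF≡sum n m (λ j i → f i j) ⟨
    sumF K n (λ j → sumF K m (λ i → f i j))      ∎
    where
    double-sumF≡sum : ∀ m n (g : Fin m → Fin n → Carrier) →
                      sumF K m (λ i → sumF K n (g i)) ≡ sum (λ i → sum (g i))
    double-sumF≡sum m n g = ≡.trans (sumF≡sum m _) (sum-cong-≗ (λ i → sumF≡sum n (g i)))

  -‿sumF : ∀ m (f : Fin m → Carrier) → - sumF K m f ≈ sumF K m (λ i → - f i)
  -‿sumF zero    f = -0#≈0#
  -‿sumF (suc m) f = trans (sym (-‿+-comm _ _)) (+-congˡ (-‿sumF m (f ∘ suc)))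

  sumF-*-zeroʳ : ∀ m (a : Fin m → Carrier) → sumF K m (λ l → a l * 0#) ≈ 0#
  sumF-*-zeroʳ m a = trans (sumF-cong m (λ l → zeroʳ (a l))) (sumF-zero m)

  -‿combination : ∀ m (a y : Fin m → Carrier) →
                  - sumF K m (λ l → a l * y l) ≈ sumF K m (λ l → a l * - y l)
  -‿combination m a y = trans (-‿sumF m _) (sumF-cong m (λ l → -‿distribʳ-* (a l) (y l)))

  eval-combination : ∀ {m d} {p : Poly K d} {q : Fin m → Poly K d} (a : Fin m → Carrier) →
                     (∀ r → p r ≈ sumF K m (λ l → a l * q l r)) →
                     ∀ x → eval K p x ≈ sumF K m (λ l → a l * eval K (q l) x)
  eval-combination {m} {d} {p} {q} a p≈ x = begin
    sumF K d (λ r → p r * xʳ r)                              ≈⟨ sumF-cong d (λ r → *-congʳ (p≈ r)) ⟩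
    sumF K d (λ r → sumF K m (λ l → a l * q l r) * xʳ r)     ≈⟨ sumF-cong d (λ r → *-distribʳ-sumF m (xʳ r) _) ⟩
    sumF K d (λ r → sumF K m (λ l → a l * q l r * xʳ r))     ≈⟨ sumF-comm d m _ ⟩
    sumF K m (λ l → sumF K d (λ r → a l * q l r * xʳ r))     ≈⟨ sumF-cong m (λ l → sumF-cong d (λ r → *-assoc _ _ _)) ⟩
    sumF K m (λ l → sumF K d (λ r → a l * (q l r * xʳ r)))   ≈⟨ sumF-cong m (λ l → *-distribˡ-sumF d (a l) _) ⟨
    sumF K m (λ l → a l * eval K (q l) x)                    ∎
    where
    xʳ : Fin d → Carrier
    xʳ r = pow K x (toℕ r)

  guarded : ∀ {n} (g : Pair n → Carrier) (i j : Fin n) → Dec (i < j) → Carrier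
  guarded g i j (yes i<j) = g (i , j , i<j)
  guarded g i j (no _)    = 0#

  -- The summand of `sumPairs` is an anonymous `with`-function; this names it.
  sumPairs-summand : ∀ n (g : Pair n → Carrier) →
                     Σ (Fin n → Fin n → Carrier) λ h → sumPairs K n g ≡ sumF K n (λ i → sumF K n (h i))
  sumPairs-summand n g = _ , ≡.refl

  sumPairs-summand-guarded : ∀ n g i j → proj₁ (sumPairs-summand n g) i j ≡ guarded g i j (i <? j)
  sumPairs-summand-guarded n g i j with i <? j
  ... | yes _ = ≡.refl
  ... | no _  = ≡.refl

  sumPairs-guarded : ∀ n (g : Pair n → Carrier) →
                     sumPairs K n g ≈ sumF K n (λ i → sumF K n (λ j → guarded g i j (i <? j)))
  sumPairs-guarded n g =
    trans (reflexive (proj₂ (sumPairs-summand n g)))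
          (sumF-cong n (λ i → sumF-cong n (λ j → reflexive (sumPairs-summand-guarded n g i j))))

  sumPairs-cong : ∀ n {g g′ : Pair n → Carrier} → (∀ e → g e ≈ g′ e) → sumPairs K n g ≈ sumPairs K n g′
  sumPairs-cong n {g} {g′} g≈g′ = begin
    sumPairs K n g                                             ≈⟨ sumPairs-guarded n g ⟩
    sumF K n (λ i → sumF K n (λ j → guarded g i j (i <? j)))   ≈⟨ sumF-cong n (λ i → sumF-cong n (λ j → guarded-cong i j (i <? j))) ⟩
    sumF K n (λ i → sumF K n (λ j → guarded g′ i j (i <? j)))  ≈⟨ sumPairs-guarded n g′ ⟨
    sumPairs K n g′                                            ∎
    where
    guarded-cong : ∀ i j (i<?j : Dec (i < j)) → guarded g i j i<?j ≈ guarded g′ i j i<?j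
    guarded-cong i j (yes _) = g≈g′ _
    guarded-cong i j (no _)  = refl

  sumPairs-combination : ∀ n m (a : Fin m → Carrier) (g : Pair n → Fin m → Carrier) →
                         sumPairs K n (λ e → sumF K m (λ l → a l * g e l)) ≈
                         sumF K m (λ l → a l * sumPairs K n (λ e → g e l))
  sumPairs-combination n m a g = begin
    sumPairs K n (λ e → sumF K m (λ l → a l * g e l))
      ≈⟨ sumPairs-guarded n _ ⟩
    sumF K n (λ i → sumF K n (λ j → guarded (λ e → sumF K m (λ l → a l * g e l)) i j (i <? j)))
      ≈⟨ sumF-cong n (λ i → sumF-cong n (λ j → guarded-combination i j (i <? j))) ⟩
    sumF K n (λ i → sumF K n (λ j → sumF K m (λ l → a l * guarded (gₗ l) i j (i <? j))))
      ≈⟨ sumF-cong n (λ i → sumF-comm n m _) ⟩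
    sumF K n (λ i → sumF K m (λ l → sumF K n (λ j → a l * guarded (gₗ l) i j (i <? j))))
      ≈⟨ sumF-comm n m _ ⟩
    sumF K m (λ l → sumF K n (λ i → sumF K n (λ j → a l * guarded (gₗ l) i j (i <? j))))
      ≈⟨ sumF-cong m (λ l → trans (*-distribˡ-sumF n (a l) _) (sumF-cong n (λ i → *-distribˡ-sumF n (a l) _))) ⟨
    sumF K m (λ l → a l * sumF K n (λ i → sumF K n (λ j → guarded (gₗ l) i j (i <? j))))
      ≈⟨ sumF-cong m (λ l → *-congˡ (sumPairs-guarded n (gₗ l))) ⟨
    sumF K m (λ l → a l * sumPairs K n (gₗ l)) ∎
    where
    gₗ : Fin m → Pair n → Carrier
    gₗ l e = g e l

    guarded-combination : ∀ i j (i<?j : Dec (i < j)) →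
                          guarded (λ e → sumF K m (λ l → a l * g e l)) i j i<?j ≈
                          sumF K m (λ l → a l * guarded (gₗ l) i j i<?j)
    guarded-combination i j (yes _) = refl
    guarded-combination i j (no _)  = sym (sumF-*-zeroʳ m a)

  Pmat-combination : ∀ {n d} (t : Fin n → Carrier) (F G : Fin n → Fin d → Poly K d)
                     (A : Fin n → Fin d → Fin d → Carrier) →
                     (∀ b k r → F b k r ≈ sumF K d (λ l → A b k l * G b l r)) →
                     ∀ e b k → Pmat K t F e b k ≈ sumF K d (λ l → A b k l * Pmat K t G e b l)
  Pmat-combination {d = d} t F G A F≈AG (i , j , _) b k with b ≟ i | b ≟ j
  ... | yes ≡.refl | _          = eval-combination (A b k) (F≈AG b k) (t j)
  ... | no _       | yes ≡.refl = trans (-‿cong (eval-combination (A b k) (F≈AG b k) (t i))) (-‿combination d (A b k) (λ l → eval K (G b l) (t i)))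
  ... | no _       | no _       = sym (sumF-*-zeroʳ d (A b k))

  rowRelations-inherited : ∀ {n d} (M N : Pair n → Fin n → Fin d → Carrier)
                           (A : Fin n → Fin d → Fin d → Carrier) →
                           (∀ e b k → M e b k ≈ sumF K d (λ l → A b k l * N e b l)) →
                           (a : Pair n → Carrier) →
                           (∀ b l → sumPairs K n (λ e → a e * N e b l) ≈ 0#) →
                           ∀ b k → sumPairs K n (λ e → a e * M e b k) ≈ 0#
  rowRelations-inherited {n} {d} M N A M≈AN a aN≈0 b k = begin
    sumPairs K n (λ e → a e * M e b k)                                ≈⟨ sumPairs-cong n (λ e → *-congˡ (M≈AN e b k)) ⟩
    sumPairs K n (λ e → a e * sumF K d (λ l → A b k l * N e b l))     ≈⟨ sumPairs-cong n (λ e → *-distribˡ-sumF d (a e) _) ⟩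
    sumPairs K n (λ e → sumF K d (λ l → a e * (A b k l * N e b l)))   ≈⟨ sumPairs-cong n (λ e → sumF-cong d (λ l → x∙yz≈y∙xz _ _ _)) ⟩
    sumPairs K n (λ e → sumF K d (λ l → A b k l * (a e * N e b l)))   ≈⟨ sumPairs-combination n d (A b k) _ ⟩
    sumF K d (λ l → A b k l * sumPairs K n (λ e → a e * N e b l))     ≈⟨ sumF-cong d (λ l → *-congˡ (aN≈0 b l)) ⟩
    sumF K d (λ l → A b k l * 0#)                                     ≈⟨ sumF-*-zeroʳ d (A b k) ⟩
    0#                                                                ∎

  RowIndep-transfer : ∀ {n d} (t : Fin n → Carrier) (F G : Fin n → Fin d → Poly K d) →
                      (∀ b → Spans K (G b)) → ∀ S → RowIndep K t F S → RowIndep K t G S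
  RowIndep-transfer {n} {d} t F G G-spans S F-indep a a-support G-relation =
    F-indep a a-support (rowRelations-inherited (Pmat K t F) (Pmat K t G) A
                           (Pmat-combination t F G A F≈AG) a G-relation)
    where
    A : Fin n → Fin d → Fin d → Carrier
    A b k = proj₁ (G-spans b (F b k))

    F≈AG : ∀ b k r → F b k r ≈ sumF K d (λ l → A b k l * G b l r)
    F≈AG b k = proj₂ (G-spans b (F b k))

lemma2p3 : {c ℓ : Level} (K : Field c ℓ) (n d : ℕ) (t : Fin n → Field.Carrier K)
           (F G : Fin n → Fin d → Poly K d) →
           (∀ i → IsBasis K (F i)) → (∀ i → IsBasis K (G i)) →
           (S : Pair n → Bool) →
           RowIndep K t F S ⇔ RowIndep K t G S
lemma2p3 K n d t F G F-basis G-basis S =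
  mk⇔ (RowIndep-transfer K t F G (proj₂ ∘ G-basis) S)
      (RowIndep-transfer K t G F (proj₂ ∘ F-basis) S)
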